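{- Let $G=(V,E)$ be an outer 1-planar graph with a fixed outer 1-planar drawing whose vertices in cyclic order along the outer boundary are $v_1,\dots,v_n$. Let $U \subset V$ be such that the induced subgraph $G[U]$ is a cycle. For every pair of vertices $u,w \in U$ such that $V[u,w] \cap U = \{u,w\}$, if $u$ and $w$ are not adjacent, then there are two edges $e_u, e_w$ of $G[U]$, incident to $u$ and $w$ respectively, such that $e_u$ and $e_w$ cross in the drawing.
   Context: A graph is outer 1-planar if it can be drawn in the plane with all vertices in convex position on the outer boundary and each edge crossed at most once (drawings are simple). For vertices $v_i, v_j$ in the cyclic order, $V[v_i,v_j]$ denotes the set of vertices $v_i, v_{i+1}, \dots, v_j$ encountered going along the cyclic order from $v_i$ to $v_j$ (indices taken cyclically). -}

module Defs where

open import Data.Nat using (ℕ; suc; _≤_)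
open import Data.Fin using (Fin; _<_; toℕ; suc)
open import Data.Fin.Base using (fromℕ<)
open import Data.Product using (Σ; ∃; _×_; _,_)
open import Data.Sum using (_⊎_)
open import Relation.Nullary using (¬_)
open import Relation.Binary.PropositionalEquality using (_≡_; _≢_)
open import Function.Bundles using (_⇔_)
open import Function.Definitions using (Injective)
open import Data.Nat.DivMod using (_mod_)

-- Vertices of the drawing are Fin n; the cyclic order along the outer
-- boundary is 0,1,...,n-1 (then back to 0).

record Graph (n : ℕ) : Set₁ where
  field
    Adj     : Fin n → Fin n → Set
    sym     : ∀ {x y} → Adj x y → Adj y x
    irrefl  : ∀ {x} → ¬ Adj x x
open Graph public

-- x lies strictly inside the cyclic interval from a to b
-- (going from a in increasing cyclic order until b), i.e. x ∈ V[a,b] ∖ {a,b}.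
StrictlyBetween : ∀ {n} → Fin n → Fin n → Fin n → Set
StrictlyBetween a x b = (a < b × a < x × x < b) ⊎ (b < a × (a < x ⊎ x < b))

-- In a simple drawing with vertices in convex position on the outer boundary,
-- the edges ab and cd cross iff their four endpoints are distinct and
-- alternate along the cyclic order.
Cross : ∀ {n} → Fin n → Fin n → Fin n → Fin n → Set
Cross a b c d =
  a ≢ b × a ≢ c × a ≢ d × b ≢ c × b ≢ d × c ≢ d ×
  ((StrictlyBetween a c b × ¬ StrictlyBetween a d b) ⊎
   (¬ StrictlyBetween a c b × StrictlyBetween a d b))

SameEdge : ∀ {n} → Fin n → Fin n → Fin n → Fin n → Set
SameEdge c d e f = (c ≡ e × d ≡ f) ⊎ (c ≡ f × d ≡ e)

-- The drawing with vertex order 0,...,n-1 is outer 1-planar: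
-- every edge is crossed by at most one edge.
Outer1Planar : ∀ {n} → Graph n → Set
Outer1Planar {n} G =
  ∀ (a b c d e f : Fin n) → Adj G a b → Adj G c d → Adj G e f →
  Cross a b c d → Cross a b e f → SameEdge c d e f

csuc : ∀ {k} → Fin (suc k) → Fin (suc k)
csuc {k} i = suc (toℕ i) mod suc k

-- The induced subgraph G[U] is a cycle: U is enumerated without repetition
-- by c : Fin k → Fin n with k ≥ 3, and two vertices of U are adjacent in G
-- iff they are cyclically consecutive in this enumeration.
InducedCycle : ∀ {n} → Graph n → (Fin n → Set) → Set
InducedCycle {n} G U =
  Σ ℕ λ k → Σ (Fin (suc (suc (suc k))) → Fin n) λ c →
    Injective _≡_ _≡_ c ×
    (∀ x → U x ⇔ ∃ λ i → c i ≡ x) ×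
    (∀ i j → Adj G (c i) (c j) ⇔ (j ≡ csuc i ⊎ i ≡ csuc j))

{-# OPTIONS --safe #-}
-- Read the boundary starting at w; by the hypothesis on V[u,w], u is then the last vertex
-- of U. Deleting w from the cycle G[U] leaves a path between the two neighbours of w; orient
-- it so that it ends at the later one, y. On its way to u the path leaves the part of the
-- boundary before y along an edge tt′ that jumps over y, so tt′ crosses wy. If t′ = u we are
-- done. Otherwise the path continues through u and has to re-enter the gap between t and t′
-- to end at y; the re-entering edge crosses tt′ as well, so tt′ is crossed twice.
module Submission where

open import Defs renaming (sym to Adj-sym)
open import Data.Nat using (ℕ; zero; suc; _+_; _∸_; _≤_; _<_; z≤n; s≤s; z<s; s≤s⁻¹; _<?_; NonZero; _%_)
open import Data.Nat.Properties
open import Data.Nat.DivMod using (_mod_; %-distribˡ-+; m%n%n≡m%n; [m+n]%n≡m%n; m<n⇒m%n≡m; m%n<n)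
open import Data.Fin using (Fin; toℕ)
open import Data.Fin.Properties using (toℕ<n; toℕ-injective; toℕ-fromℕ<)
open import Data.Product using (Σ; ∃; _×_; _,_; proj₁; proj₂)
open import Data.Sum using (_⊎_; inj₁; inj₂)
open import Data.Empty using (⊥; ⊥-elim)
open import Relation.Nullary using (¬_; yes; no; contradiction)
open import Relation.Nullary.Decidable using (_×-dec_)
open import Relation.Unary using (Decidable)
open import Relation.Binary.PropositionalEquality
open import Relation.Binary.Definitions using (tri<; tri≈; tri>)
open import Function.Base using (_∘_)
open import Function.Bundles using (Equivalence; _⇔_)

private
  variable
    n a b x : ℕ
    p q r s : Fin n

transition : (P : ℕ → Set) → Decidable P → a ≤ b → ¬ P a → P b →
  ∃ λ k → a ≤ k × k < b × ¬ P k × P (suc k)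
transition {b = zero} P P? a≤0 ¬Pa Pb = contradiction (subst P (sym (n≤0⇒n≡0 a≤0)) Pb) ¬Pa
transition {b = suc b} P P? a≤1+b ¬Pa P1+b with m≤n⇒m<n∨m≡n a≤1+b
... | inj₂ refl = contradiction P1+b ¬Pa
... | inj₁ a≤b with P? b
...   | no ¬Pb = b , s≤s⁻¹ a≤b , n<1+n b , ¬Pb , P1+b
...   | yes Pb with transition P P? (s≤s⁻¹ a≤b) ¬Pa Pb
...     | k , a≤k , k<b , ¬Pk , P1+k = k , a≤k , m<n⇒m<1+n k<b , ¬Pk , P1+k

outside-interval : x ≢ a → x ≢ b → ¬ (a < x × x < b) → x < a ⊎ b < x
outside-interval {x} {a} {b} x≢a x≢b x∉ with <-cmp x a | <-cmp x b
... | tri< x<a _ _ | _            = inj₁ x<a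
... | tri≈ _ x≡a _ | _            = contradiction x≡a x≢a
... | tri> _ _ a<x | tri< x<b _ _ = contradiction (a<x , x<b) x∉
... | tri> _ _ _   | tri≈ _ x≡b _ = contradiction x≡b x≢b
... | tri> _ _ _   | tri> _ _ b<x = inj₂ b<x

CyclicBetween : ℕ → ℕ → ℕ → Set
CyclicBetween a x b = (a < x × x < b) ⊎ (x < b × b < a) ⊎ (b < a × a < x)

CyclicBetween-rotate : CyclicBetween a x b → CyclicBetween x b a
CyclicBetween-rotate (inj₁ p)        = inj₂ (inj₂ p)
CyclicBetween-rotate (inj₂ (inj₁ p)) = inj₁ p
CyclicBetween-rotate (inj₂ (inj₂ p)) = inj₂ (inj₁ p)

CyclicBetween-asym : CyclicBetween a x b → ¬ CyclicBetween a b x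
CyclicBetween-asym (inj₁ (_ , x<b))          (inj₁ (_ , b<x))          = <-asym x<b b<x
CyclicBetween-asym (inj₁ (a<x , _))          (inj₂ (inj₁ (_ , x<a)))   = <-asym a<x x<a
CyclicBetween-asym (inj₁ (a<x , _))          (inj₂ (inj₂ (x<a , _)))   = <-asym a<x x<a
CyclicBetween-asym (inj₂ (inj₁ (_ , b<a)))   (inj₁ (a<b , _))          = <-asym b<a a<b
CyclicBetween-asym (inj₂ (inj₁ (x<b , _)))   (inj₂ (inj₁ (b<x , _)))   = <-asym x<b b<x
CyclicBetween-asym (inj₂ (inj₁ (_ , b<a)))   (inj₂ (inj₂ (_ , a<b)))   = <-asym b<a a<b
CyclicBetween-asym (inj₂ (inj₂ (b<a , _)))   (inj₁ (a<b , _))          = <-asym b<a a<b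
CyclicBetween-asym (inj₂ (inj₂ (_ , a<x)))   (inj₂ (inj₁ (_ , x<a)))   = <-asym a<x x<a
CyclicBetween-asym (inj₂ (inj₂ (b<a , _)))   (inj₂ (inj₂ (_ , a<b)))   = <-asym b<a a<b

CyclicBetween-distinct : CyclicBetween a x b → a ≢ x × x ≢ b × a ≢ b
CyclicBetween-distinct (inj₁ (a<x , x<b)) =
  <⇒≢ a<x , <⇒≢ x<b , <⇒≢ (<-trans a<x x<b)
CyclicBetween-distinct (inj₂ (inj₁ (x<b , b<a))) =
  ≢-sym (<⇒≢ (<-trans x<b b<a)) , <⇒≢ x<b , ≢-sym (<⇒≢ b<a)
CyclicBetween-distinct (inj₂ (inj₂ (b<a , a<x))) =
  <⇒≢ a<x , ≢-sym (<⇒≢ (<-trans b<a a<x)) , ≢-sym (<⇒≢ b<a)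

CyclicBetween-total : a ≢ x → x ≢ b → a ≢ b → CyclicBetween a x b ⊎ CyclicBetween a b x
CyclicBetween-total {a} {x} {b} a≢x x≢b a≢b with <-cmp a x | <-cmp x b | <-cmp a b
... | tri≈ _ a≡x _ | _            | _            = contradiction a≡x a≢x
... | _            | tri≈ _ x≡b _ | _            = contradiction x≡b x≢b
... | _            | _            | tri≈ _ a≡b _ = contradiction a≡b a≢b
... | tri< a<x _ _ | tri< x<b _ _ | _            = inj₁ (inj₁ (a<x , x<b))
... | tri< a<x _ _ | tri> _ _ b<x | tri< a<b _ _ = inj₂ (inj₁ (a<b , b<x))
... | tri< a<x _ _ | tri> _ _ _   | tri> _ _ b<a = inj₁ (inj₂ (inj₂ (b<a , a<x)))
... | tri> _ _ x<a | tri< _ _ _   | tri< a<b _ _ = inj₂ (inj₂ (inj₂ (x<a , a<b)))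
... | tri> _ _ _   | tri< x<b _ _ | tri> _ _ b<a = inj₁ (inj₂ (inj₁ (x<b , b<a)))
... | tri> _ _ x<a | tri> _ _ b<x | _            = inj₂ (inj₂ (inj₁ (b<x , x<a)))

-- Moving the block [0, W) above n turns the cyclic order of [0, n) read from W into the
-- linear order of ℕ.
module Rotation (n W : ℕ) where

  rotate : ℕ → ℕ
  rotate v with v <? W
  ... | yes _ = v + n
  ... | no  _ = v

  rotate-increasing : a < x → x < b → b < n → CyclicBetween (rotate a) (rotate x) (rotate b)
  rotate-increasing {a} {x} {b} a<x x<b b<n with a <? W | x <? W | b <? W
  ... | yes _   | yes _   | yes _   = inj₁ (+-monoˡ-< n a<x , +-monoˡ-< n x<b)
  ... | yes _   | yes _   | no  _   = inj₂ (inj₂ (<-≤-trans b<n (m≤n+m n a) , +-monoˡ-< n a<x))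
  ... | yes _   | no  _   | no  _   = inj₂ (inj₁ (x<b , <-≤-trans b<n (m≤n+m n a)))
  ... | no  _   | no  _   | no  _   = inj₁ (a<x , x<b)
  ... | no  a≮W | yes x<W | _       = contradiction (<-trans a<x x<W) a≮W
  ... | _       | no  x≮W | yes b<W = contradiction (<-trans x<b b<W) x≮W

  rotate-preserves : a < n → x < n → b < n →
    CyclicBetween a x b → CyclicBetween (rotate a) (rotate x) (rotate b)
  rotate-preserves a<n x<n b<n (inj₁ (a<x , x<b)) = rotate-increasing a<x x<b b<n
  rotate-preserves a<n x<n b<n (inj₂ (inj₁ (x<b , b<a))) =
    CyclicBetween-rotate (CyclicBetween-rotate (rotate-increasing x<b b<a a<n))
  rotate-preserves a<n x<n b<n (inj₂ (inj₂ (b<a , a<x))) =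
    CyclicBetween-rotate (rotate-increasing b<a a<x x<n)

  rotate-reflects : a < n → x < n → b < n →
    CyclicBetween (rotate a) (rotate x) (rotate b) → CyclicBetween a x b
  rotate-reflects {a} {x} {b} a<n x<n b<n between
    with a≢x , x≢b , a≢b ← CyclicBetween-distinct between
    with CyclicBetween-total (a≢x ∘ cong rotate) (x≢b ∘ cong rotate) (a≢b ∘ cong rotate)
  ... | inj₁ abx = abx
  ... | inj₂ axb = contradiction between (CyclicBetween-asym (rotate-preserves a<n b<n x<n axb))

  rotate-injective : a < n → b < n → rotate a ≡ rotate b → a ≡ b
  rotate-injective {a} {b} a<n b<n eq with a <? W | b <? W
  ... | yes _ | yes _ = +-cancelʳ-≡ n a b eq
  ... | yes _ | no  _ = contradiction (subst (n ≤_) eq (m≤n+m n a)) (<⇒≱ b<n)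
  ... | no  _ | yes _ = contradiction (subst (n ≤_) (sym eq) (m≤n+m n b)) (<⇒≱ a<n)
  ... | no  _ | no  _ = eq

  rotate-minimum : W ≤ n → rotate W ≤ rotate a
  rotate-minimum {a} W≤n with W <? W | a <? W
  ... | yes W<W | _       = contradiction W<W (<-irrefl refl)
  ... | no  _   | yes _   = ≤-trans W≤n (m≤n+m n a)
  ... | no  _   | no  a≮W = ≮⇒≥ a≮W

StrictlyBetween⇒CyclicBetween : StrictlyBetween p q r → CyclicBetween (toℕ p) (toℕ q) (toℕ r)
StrictlyBetween⇒CyclicBetween (inj₁ (_ , p<q , q<r))   = inj₁ (p<q , q<r)
StrictlyBetween⇒CyclicBetween (inj₂ (r<p , inj₁ p<q)) = inj₂ (inj₂ (r<p , p<q))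
StrictlyBetween⇒CyclicBetween (inj₂ (r<p , inj₂ q<r)) = inj₂ (inj₁ (q<r , r<p))

CyclicBetween⇒StrictlyBetween : CyclicBetween (toℕ p) (toℕ q) (toℕ r) → StrictlyBetween p q r
CyclicBetween⇒StrictlyBetween (inj₁ (p<q , q<r))        = inj₁ (<-trans p<q q<r , p<q , q<r)
CyclicBetween⇒StrictlyBetween (inj₂ (inj₁ (q<r , r<p))) = inj₂ (r<p , inj₂ q<r)
CyclicBetween⇒StrictlyBetween (inj₂ (inj₂ (r<p , p<q))) = inj₂ (r<p , inj₁ p<q)

StrictlyBetween-distinct : StrictlyBetween p q r → p ≢ q × q ≢ r × p ≢ r
StrictlyBetween-distinct between
  with p≢q , q≢r , p≢r ← CyclicBetween-distinct (StrictlyBetween⇒CyclicBetween between)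
  = p≢q ∘ cong toℕ , q≢r ∘ cong toℕ , p≢r ∘ cong toℕ

StrictlyBetween-asym : StrictlyBetween p q r → ¬ StrictlyBetween r q p
StrictlyBetween-asym pqr rqp =
  CyclicBetween-asym (StrictlyBetween⇒CyclicBetween pqr)
    (CyclicBetween-rotate (CyclicBetween-rotate (StrictlyBetween⇒CyclicBetween rqp)))

Cross-intro : StrictlyBetween p r q → StrictlyBetween q s p → Cross p q r s
Cross-intro prq qsp
  with p≢r , r≢q , p≢q ← StrictlyBetween-distinct prq
     | q≢s , s≢p , _   ← StrictlyBetween-distinct qsp
  = p≢q , p≢r , ≢-sym s≢p , ≢-sym r≢q , q≢s , (λ { refl → StrictlyBetween-asym prq qsp }) ,
    inj₁ (prq , StrictlyBetween-asym qsp)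

module Rank {n : ℕ} (w : Fin n) where
  open Rotation n (toℕ w)

  rank : Fin n → ℕ
  rank p = rotate (toℕ p)

  rank-reflects : CyclicBetween (rank p) (rank q) (rank r) → StrictlyBetween p q r
  rank-reflects {p = p} {q} {r} =
    CyclicBetween⇒StrictlyBetween ∘ rotate-reflects (toℕ<n p) (toℕ<n q) (toℕ<n r)

  rank-injective : rank p ≡ rank q → p ≡ q
  rank-injective {p = p} {q} = toℕ-injective ∘ rotate-injective (toℕ<n p) (toℕ<n q)

  rank-minimum : p ≢ w → rank w < rank p
  rank-minimum {p = p} p≢w =
    ≤∧≢⇒< (rotate-minimum (<⇒≤ (toℕ<n w))) (p≢w ∘ sym ∘ rank-injective)

  Cross-by-rank : rank q < rank s → rank s < rank p → rank r < rank q ⊎ rank p < rank r →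
    Cross p q r s
  Cross-by-rank q<s s<p (inj₁ r<q) =
    Cross-intro (rank-reflects (inj₂ (inj₁ (r<q , <-trans q<s s<p)))) (rank-reflects (inj₁ (q<s , s<p)))
  Cross-by-rank q<s s<p (inj₂ p<r) =
    Cross-intro (rank-reflects (inj₂ (inj₂ (<-trans q<s s<p , p<r)))) (rank-reflects (inj₁ (q<s , s<p)))

CrossingEdges : (G : Graph n) → (Fin n → Set) → Fin n → Fin n → Set
CrossingEdges G U u w = ∃ λ x → ∃ λ y → U x × Adj G u x × U y × Adj G w y × Cross u x w y

record PathAround {n : ℕ} (G : Graph n) (U : Fin n → Set) (w : Fin n) : Set where
  field
    len            : ℕ
    vertex         : ℕ → Fin n
    injective      : ∀ {i j} → i ≤ len → j ≤ len → vertex i ≡ vertex j → i ≡ j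
    adjacent       : ∀ {i} → i < len → Adj G (vertex i) (vertex (suc i))
    adjacent-first : Adj G w (vertex 0)
    adjacent-last  : Adj G w (vertex len)
    avoids         : ∀ {i} → i ≤ len → vertex i ≢ w
    in-U           : ∀ {i} → i ≤ len → U (vertex i)
    covers         : ∀ {p} → U p → p ≢ w → ∃ λ i → i ≤ len × vertex i ≡ p

reverse : {G : Graph n} {U : Fin n → Set} {w : Fin n} → PathAround G U w → PathAround G U w
reverse {G = G} {U} {w} P = record
  { len            = P.len
  ; vertex         = λ i → P.vertex (P.len ∸ i)
  ; injective      = λ {i} {j} i≤len j≤len eq →
                       ∸-cancelˡ-≡ i≤len j≤len (P.injective (m∸n≤m P.len i) (m∸n≤m P.len j) eq)
  ; adjacent       = adjacent
  ; adjacent-first = P.adjacent-last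
  ; adjacent-last  = subst (Adj G w ∘ P.vertex) (sym (n∸n≡0 P.len)) P.adjacent-first
  ; avoids         = λ {i} _ → P.avoids (m∸n≤m P.len i)
  ; in-U           = λ {i} _ → P.in-U (m∸n≤m P.len i)
  ; covers         = covers
  }
  where
  module P = PathAround P

  adjacent : ∀ {i} → i < P.len → Adj G (P.vertex (P.len ∸ i)) (P.vertex (P.len ∸ suc i))
  adjacent {i} i<len =
    subst (λ j → Adj G (P.vertex j) (P.vertex (P.len ∸ suc i))) (sym (+-∸-assoc 1 i<len))
      (Adj-sym G (P.adjacent (∸-monoʳ-< z<s i<len)))

  covers : ∀ {p} → U p → p ≢ w → ∃ λ i → i ≤ P.len × P.vertex (P.len ∸ i) ≡ p
  covers p∈U p≢w with i , i≤len , vi≡p ← P.covers p∈U p≢w =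
    P.len ∸ i , m∸n≤m P.len i , trans (cong P.vertex (m∸[m∸n]≡n i≤len)) vi≡p

module Crossing {n : ℕ} {G : Graph n} (planar : Outer1Planar G) {U : Fin n → Set} {u w : Fin n}
  (u∈U : U u) (u≢w : u ≢ w) (gap : ∀ p → StrictlyBetween u p w → ¬ U p) (u≁w : ¬ Adj G u w) where

  open Rank w

  rank≤rank-u : U p → rank p ≤ rank u
  rank≤rank-u {p = p} p∈U =
    ≮⇒≥ λ u<p → gap p (rank-reflects (inj₂ (inj₂ (rank-minimum u≢w , u<p)))) p∈U

  Ascending : PathAround G U w → Set
  Ascending P = rank (vertex 0) ≤ rank (vertex len)
    where open PathAround P

  oriented : PathAround G U w → Σ (PathAround G U w) Ascending
  oriented P with ≤-total (rank (vertex 0)) (rank (vertex len))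
    where open PathAround P
  ... | inj₁ ascending  = P , ascending
  ... | inj₂ descending =
    reverse P , subst (λ i → rank (vertex len) ≤ rank (vertex i)) (sym (n∸n≡0 len)) descending
    where open PathAround P

  module Along (P : PathAround G U w) where
    open PathAround P

    level : ℕ → ℕ
    level i = rank (vertex i)

    level-injective : ∀ {i j} → i ≤ len → j ≤ len → i ≢ j → level i ≢ level j
    level-injective i≤len j≤len i≢j = i≢j ∘ injective i≤len j≤len ∘ rank-injective

    level≤u : ∀ {i j} → i ≤ len → vertex j ≡ u → level i ≤ level j
    level≤u i≤len refl = rank≤rank-u (in-U i≤len)

    u-index : ∃ λ j → j < len × vertex j ≡ u
    u-index with j , j≤len , vj≡u ← covers u∈U u≢w =
      j , ≤∧≢⇒< j≤len (λ { refl → u≁w (subst (λ p → Adj G p w) vj≡u (Adj-sym G adjacent-last)) }) , vj≡u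

    last<u : ∀ {j} → j < len → vertex j ≡ u → level len < level j
    last<u j<len vj≡u =
      ≤∧≢⇒< (level≤u ≤-refl vj≡u) (level-injective ≤-refl (<⇒≤ j<len) (≢-sym (<⇒≢ j<len)))

    jumps-over-last : ¬ level len < level 0 → ∀ {j} → j < len → vertex j ≡ u →
      ∃ λ i → i < j × level i < level len × level len < level (suc i)
    jumps-over-last ascending {j} j<len vj≡u
      with i , _ , i<j , last≮i , last<1+i ← transition (λ i → level len < level i) (λ i → level len <? level i)
                                               z≤n ascending (last<u j<len vj≡u)
      = i , i<j , ≤∧≢⇒< (≮⇒≥ last≮i) (level-injective (<⇒≤ i<len) ≤-refl (<⇒≢ i<len)) , last<1+i
      where
      i<len : i < len
      i<len = <-trans i<j j<len

    crosses-last : ∀ {i} → i < len → level i < level len → level len < level (suc i) →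
      Cross (vertex (suc i)) (vertex i) w (vertex len)
    crosses-last i<len i<last last<1+i =
      Cross-by-rank i<last last<1+i (inj₁ (rank-minimum (avoids (<⇒≤ i<len))))

    InsideGap : ℕ → ℕ → Set
    InsideGap i m = level i < level m × level m < level (suc i)

    crosses-into-gap : ∀ {i k} → suc i < k → k < len → ¬ InsideGap i k → InsideGap i (suc k) →
      Cross (vertex (suc i)) (vertex i) (vertex k) (vertex (suc k))
    crosses-into-gap {i} {k} 1+i<k k<len k∉gap (i<1+k , 1+k<1+i) =
      Cross-by-rank i<1+k 1+k<1+i (outside-interval (level-injective k≤len i≤len k≢i)
                                                     (level-injective k≤len 1+i≤len k≢1+i) k∉gap)
      where
      k≤len : k ≤ len
      k≤len = <⇒≤ k<len
      1+i≤len : suc i ≤ len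
      1+i≤len = <⇒≤ (<-trans 1+i<k k<len)
      i≤len : i ≤ len
      i≤len = <⇒≤ 1+i≤len
      k≢1+i : k ≢ suc i
      k≢1+i = ≢-sym (<⇒≢ 1+i<k)
      k≢i : k ≢ i
      k≢i = ≢-sym (<⇒≢ (<-trans (n<1+n i) 1+i<k))

    reenters-gap : ∀ {i j} → suc i < j → j < len → vertex j ≡ u → InsideGap i len →
      ∃ λ k → suc i < k × k < len × ¬ InsideGap i k × InsideGap i (suc k)
    reenters-gap {i} 1+i<j j<len vj≡u last∈gap
      with k , j≤k , k<len , k∉gap , 1+k∈gap ←
             transition (InsideGap i) (λ m → (level i <? level m) ×-dec (level m <? level (suc i)))
               (<⇒≤ j<len) (λ (_ , j<1+i) → <⇒≱ j<1+i (level≤u (<⇒≤ (<-trans 1+i<j j<len)) vj≡u)) last∈gap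
      = k , <-≤-trans 1+i<j j≤k , k<len , k∉gap , 1+k∈gap

    crossed-twice : ∀ {i k} → suc i < k → k < len →
      InsideGap i len → ¬ InsideGap i k → InsideGap i (suc k) → ⊥
    crossed-twice {i} {k} 1+i<k k<len (i<last , last<1+i) k∉gap 1+k∈gap =
      distinct-edges (planar (vertex (suc i)) (vertex i) w (vertex len) (vertex k) (vertex (suc k))
                        (Adj-sym G (adjacent i<len)) adjacent-last (adjacent k<len)
                        (crosses-last i<len i<last last<1+i) (crosses-into-gap 1+i<k k<len k∉gap 1+k∈gap))
      where
      i<len : i < len
      i<len = <-trans (n<1+n i) (<-trans 1+i<k k<len)
      distinct-edges : ¬ SameEdge w (vertex len) (vertex k) (vertex (suc k))
      distinct-edges (inj₁ (w≡vk , _))   = avoids (<⇒≤ k<len) (sym w≡vk)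
      distinct-edges (inj₂ (w≡v1+k , _)) = avoids k<len (sym w≡v1+k)

    crossing-edges-at : ∀ {i} → i < len → vertex (suc i) ≡ u →
      level i < level len → level len < level (suc i) → CrossingEdges G U u w
    crossing-edges-at {i} i<len refl i<last last<1+i =
      vertex i , vertex len , in-U (<⇒≤ i<len) , Adj-sym G (adjacent i<len) ,
      in-U ≤-refl , adjacent-last , crosses-last i<len i<last last<1+i

    crossing-edges : Ascending P → CrossingEdges G U u w
    crossing-edges ascending
      with j , j<len , vj≡u ← u-index
      with i , i<j , i<last , last<1+i ← jumps-over-last (≤⇒≯ ascending) j<len vj≡u
      with m≤n⇒m<n∨m≡n i<j
    ... | inj₂ refl  = crossing-edges-at (<-trans i<j j<len) vj≡u i<last last<1+i
    ... | inj₁ 1+i<j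
      with k , 1+i<k , k<len , k∉gap , 1+k∈gap ← reenters-gap 1+i<j j<len vj≡u (i<last , last<1+i)
      = ⊥-elim (crossed-twice 1+i<k k<len (i<last , last<1+i) k∉gap 1+k∈gap)

[m%d+n]%d≡[m+n]%d : ∀ m n d .{{_ : NonZero d}} → (m % d + n) % d ≡ (m + n) % d
[m%d+n]%d≡[m+n]%d m n d = begin
  (m % d + n) % d           ≡⟨ %-distribˡ-+ (m % d) n d ⟩
  (m % d % d + n % d) % d   ≡⟨ cong (λ v → (v + n % d) % d) (m%n%n≡m%n m d) ⟩
  (m % d + n % d) % d       ≡⟨ %-distribˡ-+ m n d ⟨
  (m + n) % d               ∎
  where open ≡-Reasoning

[[m+n]%d+o]%d≡m : ∀ m n o d .{{_ : NonZero d}} → n + o ≡ d → m < d → ((m + n) % d + o) % d ≡ m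
[[m+n]%d+o]%d≡m m n o d n+o≡d m<d = begin
  ((m + n) % d + o) % d   ≡⟨ [m%d+n]%d≡[m+n]%d (m + n) o d ⟩
  (m + n + o) % d         ≡⟨ cong (_% d) (+-assoc m n o) ⟩
  (m + (n + o)) % d       ≡⟨ cong (λ v → (m + v) % d) n+o≡d ⟩
  (m + d) % d             ≡⟨ [m+n]%n≡m%n m d ⟩
  m % d                   ≡⟨ m<n⇒m%n≡m m<d ⟩
  m                       ∎
  where open ≡-Reasoning

[m+o]%d≡[n+o]%d⇒m≡n : ∀ {m n o d} .{{_ : NonZero d}} → o ≤ d → m < d → n < d →
  (m + o) % d ≡ (n + o) % d → m ≡ n
[m+o]%d≡[n+o]%d⇒m≡n {m} {n} {o} {d} o≤d m<d n<d eq = begin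
  m                       ≡⟨ [[m+n]%d+o]%d≡m m o (d ∸ o) d (m+[n∸m]≡n o≤d) m<d ⟨
  ((m + o) % d + (d ∸ o)) % d ≡⟨ cong (λ v → (v + (d ∸ o)) % d) eq ⟩
  ((n + o) % d + (d ∸ o)) % d ≡⟨ [[m+n]%d+o]%d≡m n o (d ∸ o) d (m+[n∸m]≡n o≤d) n<d ⟩
  n                       ∎
  where open ≡-Reasoning

toℕ-mod : ∀ {d} .{{_ : NonZero d}} m → toℕ (m mod d) ≡ m % d
toℕ-mod m = toℕ-fromℕ< _

csuc-mod : ∀ {k} m → csuc (m mod suc k) ≡ suc m mod suc k
csuc-mod {k} m = toℕ-injective (begin
  toℕ (csuc (m mod suc k))     ≡⟨ toℕ-mod (suc (toℕ (m mod suc k))) ⟩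
  suc (toℕ (m mod suc k)) % d  ≡⟨ cong (λ v → suc v % d) (toℕ-mod m) ⟩
  suc (m % d) % d              ≡⟨ cong (_% d) (+-comm 1 (m % d)) ⟩
  (m % d + 1) % d              ≡⟨ [m%d+n]%d≡[m+n]%d m 1 d ⟩
  (m + 1) % d                  ≡⟨ cong (_% d) (+-comm m 1) ⟩
  suc m % d                    ≡⟨ toℕ-mod (suc m) ⟨
  toℕ (suc m mod d)            ∎)
  where
  open ≡-Reasoning
  d : ℕ
  d = suc k

module CyclePath {n : ℕ} {G : Graph n} {U : Fin n → Set} (k : ℕ)
  (c : Fin (suc (suc (suc k))) → Fin n) (c-injective : ∀ {i j} → c i ≡ c j → i ≡ j)
  (U⇔ : ∀ p → U p ⇔ ∃ λ i → c i ≡ p) (Adj⇔ : ∀ i j → Adj G (c i) (c j) ⇔ (j ≡ csuc i ⊎ i ≡ csuc j))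
  {w : Fin n} (w∈U : U w) where

  K : ℕ
  K = suc (suc (suc k))

  origin : Fin K
  origin = proj₁ (Equivalence.to (U⇔ w) w∈U)

  at : ℕ → Fin n
  at a = c (a mod K)

  at-step : ∀ a → Adj G (at a) (at (suc a))
  at-step a = Equivalence.from (Adj⇔ (a mod K) (suc a mod K)) (inj₁ (sym (csuc-mod a)))

  at-origin : at (toℕ origin) ≡ w
  at-origin = trans (cong c (toℕ-injective (trans (toℕ-mod (toℕ origin)) (m<n⇒m%n≡m (toℕ<n origin)))))
                    (proj₂ (Equivalence.to (U⇔ w) w∈U))

  at-period : at (K + toℕ origin) ≡ at (toℕ origin)
  at-period = cong c (toℕ-injective (begin
    toℕ ((K + toℕ origin) mod K)  ≡⟨ toℕ-mod (K + toℕ origin) ⟩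
    (K + toℕ origin) % K          ≡⟨ cong (_% K) (+-comm K (toℕ origin)) ⟩
    (toℕ origin + K) % K          ≡⟨ [m+n]%n≡m%n (toℕ origin) K ⟩
    toℕ origin % K                ≡⟨ toℕ-mod (toℕ origin) ⟨
    toℕ (toℕ origin mod K)        ∎))
    where open ≡-Reasoning

  at-injective : ∀ {a b} → a < K → b < K → at (a + toℕ origin) ≡ at (b + toℕ origin) → a ≡ b
  at-injective {a} {b} a<K b<K eq =
    [m+o]%d≡[n+o]%d⇒m≡n (<⇒≤ (toℕ<n origin)) a<K b<K
      (trans (sym (toℕ-mod (a + toℕ origin))) (trans (cong toℕ (c-injective eq)) (toℕ-mod (b + toℕ origin))))

  at-surjective : ∀ i → ∃ λ a → a < K × at (a + toℕ origin) ≡ c i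
  at-surjective i =
    steps , m%n<n (toℕ i + (K ∸ toℕ origin)) K ,
    cong c (toℕ-injective (trans (toℕ-mod (steps + toℕ origin))
      ([[m+n]%d+o]%d≡m (toℕ i) (K ∸ toℕ origin) (toℕ origin) K (m∸n+n≡m (<⇒≤ (toℕ<n origin))) (toℕ<n i))))
    where
    steps : ℕ
    steps = (toℕ i + (K ∸ toℕ origin)) % K

  path : PathAround G U w
  path = record
    { len            = suc k
    ; vertex         = λ i → at (suc i + toℕ origin)
    ; injective      = λ i≤len j≤len eq → suc-injective (at-injective (s≤s (s≤s i≤len)) (s≤s (s≤s j≤len)) eq)
    ; adjacent       = λ {i} _ → at-step (suc i + toℕ origin)
    ; adjacent-first = subst (λ p → Adj G p (at (suc (toℕ origin)))) at-origin (at-step (toℕ origin))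
    ; adjacent-last  = Adj-sym G (subst (Adj G (at (suc (suc k) + toℕ origin))) (trans at-period at-origin)
                                    (at-step (suc (suc k) + toℕ origin)))
    ; avoids         = λ {i} i≤len vi≡w →
                         1+n≢0 (at-injective (s≤s (s≤s i≤len)) z<s (trans vi≡w (sym at-origin)))
    ; in-U           = λ {i} _ → Equivalence.from (U⇔ (at (suc i + toℕ origin))) (_ , refl)
    ; covers         = covers
    }
    where
    covers : ∀ {p} → U p → p ≢ w → ∃ λ i → i ≤ suc k × at (suc i + toℕ origin) ≡ p
    covers {p} p∈U p≢w with i , ci≡p ← Equivalence.to (U⇔ p) p∈U with at-surjective i
    ... | zero  , _   , at≡ci = contradiction (trans (sym ci≡p) (trans (sym at≡ci) at-origin)) p≢w
    ... | suc m , 1+m<K , at≡ci = m , s≤s⁻¹ (s≤s⁻¹ 1+m<K) , trans at≡ci ci≡p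

proposition1 : ∀ {n : ℕ} (G : Graph n) → Outer1Planar G →
    (U : Fin n → Set) → InducedCycle G U →
    ∀ (u w : Fin n) → U u → U w → u ≢ w →
    (∀ x → StrictlyBetween u x w → ¬ U x) →
    ¬ Adj G u w →
    ∃ λ x → ∃ λ y → U x × Adj G u x × U y × Adj G w y × Cross u x w y
proposition1 G planar U (k , c , c-injective , U⇔ , Adj⇔) u w u∈U w∈U u≢w gap u≁w =
  let open Crossing {G = G} planar u∈U u≢w gap u≁w
      P , ascending = oriented (CyclePath.path k c c-injective U⇔ Adj⇔ w∈U)
  in Along.crossing-edges P ascending
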